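{- If $t\ge 2$ and $G$ is any 2-tree on $3t+2$ vertices, then $G(3t+2)$ contains $G$ as a subgraph.
   Context: A simple graph $G$ is a 2-tree if $G=K_3$, or $G$ has a vertex $v$ of degree 2 whose two neighbors are adjacent and $G-v$ is a 2-tree. $G(3t+2)$ is the graph obtained from $K_{2t+2}-v_{2t}v_{2t+2}$ (where $K_{2t+2}$ has vertices $v_1,\ldots,v_{2t+2}$) by adding new vertices $x_1,\ldots,x_t$ and joining $x_i$ to $v_1,\ldots,v_{2i}$ for $1\le i\le t$. -}

module Defs where

open import Data.Nat using (ℕ; zero; suc; _+_; _*_; _∸_; _<ᵇ_; _≡ᵇ_)
open import Data.Fin using (Fin; toℕ; punchIn)
open import Data.Bool using (Bool; true; false; _∧_; _∨_; not; if_then_else_)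
open import Data.Product using (Σ; _×_; _,_)
open import Relation.Binary.PropositionalEquality using (_≡_; refl)
open import Data.Bool.Properties using (∧-comm; ∨-comm)
open import Relation.Nullary using (¬_)
open import Function.Definitions using (Injective)

record Graph (n : ℕ) : Set where
  field
    adj   : Fin n → Fin n → Bool
    sym   : ∀ u v → adj u v ≡ adj v u
    irrefl : ∀ v → adj v v ≡ false
open Graph public

delete : ∀ {n} → Graph (suc n) → Fin (suc n) → Graph n
delete G v = record
  { adj = λ a b → adj G (punchIn v a) (punchIn v b)
  ; sym = λ a b → sym G (punchIn v a) (punchIn v b)
  ; irrefl = λ a → irrefl G (punchIn v a)
  }

count : ∀ {n} → (Fin n → Bool) → ℕ
count {zero} f = 0
count {suc n} f = (if f Data.Fin.zero then 1 else 0) + count (λ i → f (Data.Fin.suc i))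

degree : ∀ {n} → Graph n → Fin n → ℕ
degree G v = count (adj G v)

IsK3 : Graph 3 → Set
IsK3 G = ∀ u v → ¬ (u ≡ v) → adj G u v ≡ true

data TwoTree : ∀ {n} → Graph n → Set where
  base : (G : Graph 3) → IsK3 G → TwoTree G
  step : ∀ {n} (G : Graph (suc n)) (v a b : Fin (suc n)) →
         degree G v ≡ 2 →
         adj G v a ≡ true → adj G v b ≡ true → adj G a b ≡ true →
         TwoTree (delete G v) → TwoTree G

Subgraph : ∀ {m n} → Graph m → Graph n → Set
Subgraph {m} {n} G H =
  Σ (Fin m → Fin n) λ f → Injective _≡_ _≡_ f ×
    (∀ u v → adj G u v ≡ true → adj H (f u) (f v) ≡ true)

-- The graph G(3t+2), on vertex set Fin (3t+2).
-- Index j < 2t+2 stands for v_{j+1}; index 2t+2+k stands for x_{k+1}.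
-- Thus v_{2t} has index 2t-1 and v_{2t+2} has index 2t+1.
module _ (t : ℕ) where
  private
    N = 2 * t + 2
    isV : ℕ → Bool
    isV a = a <ᵇ N
    badPair : ℕ → ℕ → Bool
    badPair a b = ((a ≡ᵇ (2 * t ∸ 1)) ∧ (b ≡ᵇ (2 * t + 1)))
                ∨ ((b ≡ᵇ (2 * t ∸ 1)) ∧ (a ≡ᵇ (2 * t + 1)))
    -- x_{k+1} (index N + k) is joined to v_1..v_{2k+2}, i.e. indices < 2k+2
    xv : ℕ → ℕ → Bool
    xv x a = a <ᵇ (2 * (x ∸ N) + 2)
    adjℕ : ℕ → ℕ → Bool
    adjℕ a b with isV a | isV b
    ... | true  | true  = not (a ≡ᵇ b) ∧ not (badPair a b)
    ... | true  | false = xv b a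
    ... | false | true  = xv a b
    ... | false | false = false

    badSym : ∀ a b → badPair a b ≡ badPair b a
    badSym a b = ∨-comm ((a ≡ᵇ (2 * t ∸ 1)) ∧ (b ≡ᵇ (2 * t + 1)))
                        ((b ≡ᵇ (2 * t ∸ 1)) ∧ (a ≡ᵇ (2 * t + 1)))
    eqSym : ∀ a b → (a ≡ᵇ b) ≡ (b ≡ᵇ a)
    eqSym zero zero = refl
    eqSym zero (suc b) = refl
    eqSym (suc a) zero = refl
    eqSym (suc a) (suc b) = eqSym a b
    adjSym : ∀ a b → adjℕ a b ≡ adjℕ b a
    adjSym a b with isV a | isV b
    ... | true  | true rewrite eqSym a b | badSym a b = refl
    ... | true  | false = refl
    ... | false | true  = refl
    ... | false | false = refl
    eqRefl : ∀ a → (a ≡ᵇ a) ≡ true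
    eqRefl zero = refl
    eqRefl (suc a) = eqRefl a
    adjIrr : ∀ a → adjℕ a a ≡ false
    adjIrr a with isV a
    ... | true rewrite eqRefl a = refl
    ... | false = refl

  adjGt : Fin (3 * t + 2) → Fin (3 * t + 2) → Bool
  adjGt u v = adjℕ (toℕ u) (toℕ v)

  Gt : Graph (3 * t + 2)
  Gt = record
    { adj = adjGt
    ; sym = λ u v → adjSym (toℕ u) (toℕ v)
    ; irrefl = λ u → adjIrr (toℕ u)
    }

module Submission where

-- We prove more: for a fixed 2-tree G, every set U of 3t + 2 vertices of G,
-- with the edges G induces on it, embeds into G(3t+2).  The structural
-- input is the degeneracy of 2-trees: every nonempty vertex set U contains
-- a vertex w whose neighbours in U lie on one edge, so U has a peelable triple
-- (w; a, b) with all U-neighbours of w in {a, b}.  Consequently 2-trees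
-- have no K4, and a 4-cycle missing one diagonal has the other.
--
-- Induction step t ↦ t + 1: peel a triple off U, embed the rest into
-- G(3t+2), shift that into G(3t+5), and send a, b to the universal
-- vertices v₁, v₂ and w to x₁.  Base case t = 2: peel two triples
-- (y; c, d) and (s; a, b), call the last two vertices p, q, and place the
-- eight vertices onto G(8) by a case analysis on the remaining edges.

open import Defs hiding (sym)
open import Algebra.Properties.CommutativeSemigroup using (x∙yz≈y∙xz)
open import Data.Bool using (Bool; true; false; _∧_; _∨_; not; if_then_else_)
open import Data.Bool.Properties using (∧-zeroʳ; ∧-identityʳ; ¬-not)
import Data.Bool.Properties as Bool
open import Data.Empty using (⊥; ⊥-elim)
open import Data.Fin using (Fin; zero; suc; toℕ; fromℕ<; punchIn; punchOut; #_)
open import Data.Fin.Properties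
  using (_≟_; all?; any?; toℕ-fromℕ<; toℕ<n; toℕ-injective; punchIn-punchOut; punchIn-injective)
open import Data.List using (List; []; _∷_; length; lookup)
open import Data.List.Membership.Propositional using (_∈_)
open import Data.List.Relation.Unary.All using (All; []; _∷_)
import Data.List.Relation.Unary.All as All
open import Data.List.Relation.Unary.All.Properties using (¬Any⇒All¬; ++⁺)
open import Data.List.Relation.Unary.AllPairs using ([]; _∷_)
open import Data.List.Relation.Unary.Any using (here; there; index)
import Data.List.Relation.Unary.Any as Any
open import Data.List.Relation.Unary.Any.Properties using (lookup-index)
open import Data.List.Relation.Unary.Unique.Propositional using (Unique)
open import Data.Nat using (ℕ; zero; suc; _+_; _*_; _∸_; _≤_; _<_; z≤n; s≤s; _<ᵇ_; _≡ᵇ_)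
open import Data.Nat.Properties
  using ( ≤-refl; ≤-pred; ≤-reflexive; ≤-trans; n≤1+n; m≤n⇒m≤1+n; m≤n+m; <-irrefl; ≤⇒≯; suc-injective
        ; +-suc; +-identityʳ; +-monoʳ-≤; +-monoˡ-≤; +-cancelˡ-≡; +-cancelˡ-<; +-∸-assoc
        ; +-commutativeSemigroup)
open import Data.Nat.Tactic.RingSolver using (solve-∀)
open import Data.Product using (∃; _×_; _,_; proj₁; proj₂)
open import Data.Product.Properties using (≡-dec)
open import Data.Sum using (_⊎_; inj₁; inj₂; [_,_]′)
import Data.Sum as Sum
open import Data.Vec using (Vec; []; _∷_)
import Data.Vec as Vec
open import Function using (_∘_; case_of_)
open import Relation.Nullary using (¬_; Dec; yes; no; does)
open import Relation.Nullary.Decidable using (_⊎-dec_; toWitness; True)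
open import Relation.Binary.PropositionalEquality

VertexSet : ℕ → Set
VertexSet n = Fin n → Bool

_∈ˢ_ : ∀ {n} → Fin n → VertexSet n → Set
u ∈ˢ A = A u ≡ true

_∈?_ : ∀ {n} (u : Fin n) (L : List (Fin n)) → Dec (u ∈ L)
u ∈? L = Any.any? (u ≟_) L

indicator : Bool → ℕ
indicator b = if b then 1 else 0

module _ {n : ℕ} where

  _-_ : VertexSet n → Fin n → VertexSet n
  (A - e) u = A u ∧ not (does (u ≟ e))

  _∖_ : VertexSet n → List (Fin n) → VertexSet n
  A ∖ [] = A
  A ∖ (e ∷ L) = (A ∖ L) - e

  -intro : ∀ A {e u} → u ∈ˢ A → u ≢ e → u ∈ˢ (A - e)
  -intro A {e} {u} u∈A u≢e with u ≟ e
  ... | yes u≡e = ⊥-elim (u≢e u≡e)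
  ... | no _ rewrite u∈A = refl

  -elim : ∀ A {e u} → u ∈ˢ (A - e) → u ∈ˢ A × u ≢ e
  -elim A {e} {u} h with A u | u ≟ e
  ... | true  | no u≢e = refl , u≢e
  ... | true  | yes _  = case h of λ ()
  ... | false | _      = case h of λ ()

  ∖-intro : ∀ A L {u} → u ∈ˢ A → All (u ≢_) L → u ∈ˢ (A ∖ L)
  ∖-intro A [] u∈A [] = u∈A
  ∖-intro A (e ∷ L) u∈A (u≢e ∷ u∉L) = -intro (A ∖ L) (∖-intro A L u∈A u∉L) u≢e

  ∖-elim : ∀ A L {u} → u ∈ˢ (A ∖ L) → u ∈ˢ A × All (u ≢_) L
  ∖-elim A [] u∈A = u∈A , []
  ∖-elim A (e ∷ L) h with -elim (A ∖ L) h
  ... | h′ , u≢e with ∖-elim A L h′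
  ...   | u∈A , u∉L = u∈A , (u≢e ∷ u∉L)

module _ {n : ℕ} where

  ⟦_⟧ : List (Fin n) → VertexSet n
  ⟦ L ⟧ u = does (u ∈? L)

  ⟦⟧-intro : ∀ L {u} → u ∈ L → u ∈ˢ ⟦ L ⟧
  ⟦⟧-intro L {u} u∈L with u ∈? L
  ... | yes _   = refl
  ... | no u∉L = ⊥-elim (u∉L u∈L)

  ⟦⟧-elim : ∀ L {u} → u ∈ˢ ⟦ L ⟧ → u ∈ L
  ⟦⟧-elim L {u} h with u ∈? L
  ... | yes u∈L = u∈L
  ... | no _    = case h of λ ()

count-ext : ∀ {n} {f g : VertexSet n} → (∀ i → f i ≡ g i) → count f ≡ count g
count-ext {zero} _ = refl
count-ext {suc n} f≗g = cong₂ _+_ (cong indicator (f≗g zero)) (count-ext (f≗g ∘ suc))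

count-split : ∀ {n} (A : VertexSet n) e → count A ≡ indicator (A e) + count (A - e)
count-split {suc n} A zero =
  cong (indicator (A zero) +_) (cong₂ _+_ (cong indicator (sym (∧-zeroʳ (A zero))))
                                         (count-ext (λ i → sym (∧-identityʳ (A (suc i))))))
count-split {suc n} A (suc e) = begin
  indicator (A zero) + count (A ∘ suc)
    ≡⟨ cong (indicator (A zero) +_) (count-split (A ∘ suc) e) ⟩
  indicator (A zero) + (indicator (A (suc e)) + count ((A ∘ suc) - e))
    ≡⟨ x∙yz≈y∙xz +-commutativeSemigroup (indicator (A zero)) (indicator (A (suc e))) _ ⟩
  indicator (A (suc e)) + (indicator (A zero) + count ((A ∘ suc) - e))
    ≡⟨ cong (λ b → indicator (A (suc e)) + (indicator b + count ((A ∘ suc) - e))) (sym (∧-identityʳ (A zero))) ⟩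
  indicator (A (suc e)) + count (A - suc e) ∎
  where open ≡-Reasoning

count-remove : ∀ {n} (A : VertexSet n) {e} → e ∈ˢ A → count A ≡ suc (count (A - e))
count-remove A {e} e∈A = trans (count-split A e) (cong (λ b → indicator b + count (A - e)) e∈A)

count-pos : ∀ {n} (A : VertexSet n) {u} → u ∈ˢ A → 0 < count A
count-pos A u∈A rewrite count-remove A u∈A = s≤s z≤n

member : ∀ {n} (A : VertexSet n) → 0 < count A → ∃ (_∈ˢ A)
member {suc n} A pos with A zero in e
... | true  = zero , e
... | false with member (A ∘ suc) pos
...   | u , u∈A = suc u , u∈A

count-∖ : ∀ {n} (A : VertexSet n) L → count A ≤ length L + count (A ∖ L)
count-∖ A [] = ≤-refl
count-∖ A (e ∷ L) =
  ≤-trans (count-∖ A L) (≤-trans (+-monoʳ-≤ (length L) removal) (≤-reflexive (+-suc (length L) _)))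
  where
  removal : count (A ∖ L) ≤ suc (count ((A ∖ L) - e))
  removal with (A ∖ L) e in e∈
  ... | true  = ≤-reflexive (count-remove (A ∖ L) e∈)
  ... | false = ≤-trans (≤-reflexive (trans (count-split (A ∖ L) e) (cong (λ b → indicator b + count ((A ∖ L) - e)) e∈))) (n≤1+n _)

count-∖-exact : ∀ {n} (A : VertexSet n) L → Unique L → All (_∈ˢ A) L → count A ≡ length L + count (A ∖ L)
count-∖-exact A [] _ _ = refl
count-∖-exact A (e ∷ L) (e∉L ∷ uniq) (e∈A ∷ L⊆A) = begin
  count A                              ≡⟨ count-∖-exact A L uniq L⊆A ⟩
  length L + count (A ∖ L)             ≡⟨ cong (length L +_) (count-remove (A ∖ L) (∖-intro A L e∈A e∉L)) ⟩
  length L + suc (count (A ∖ (e ∷ L))) ≡⟨ +-suc (length L) _ ⟩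
  suc (length L) + count (A ∖ (e ∷ L)) ∎
  where open ≡-Reasoning

pick : ∀ {n} (A : VertexSet n) L → length L < count A → ∃ λ u → u ∈ˢ A × All (u ≢_) L
pick A L larger with member (A ∖ L) rest-nonempty
  where
  rest-nonempty : 0 < count (A ∖ L)
  rest-nonempty = +-cancelˡ-< (length L) 0 _
    (≤-trans (≤-reflexive (cong suc (+-identityʳ (length L)))) (≤-trans larger (count-∖ A L)))
... | u , u∈ = u , ∖-elim A L u∈

pick-preferring : ∀ {n} (A : VertexSet n) z → 0 < count A → ∃ λ u → u ∈ˢ A × (z ∈ˢ A → u ≡ z)
pick-preferring A z pos with A z in z∈
... | true  = z , z∈ , λ _ → refl
... | false with member A pos
...   | u , u∈ = u , u∈ , λ ()

shrink : ∀ {n} (A : VertexSet n) {e k} → e ∈ˢ A → suc k ≤ count A → k ≤ count (A - e)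
shrink A e∈A k<count = ≤-pred (subst (_ ≤_) (count-remove A e∈A) k<count)

cover-pair : ∀ {n} (B : VertexSet n) x y → 2 ≤ count B →
  ∃ λ a → ∃ λ b → a ∈ˢ B × b ∈ˢ (B - a) × (∀ {u} → u ∈ˢ B → u ≡ x ⊎ u ≡ y → u ≡ a ⊎ u ≡ b)
cover-pair B x y two with pick-preferring B x (≤-trans (s≤s z≤n) two)
... | a , a∈ , a-is-x with pick-preferring (B - a) y (shrink B a∈ two)
...   | b , b∈ , b-is-y = a , b , a∈ , b∈ , covers
  where
  covers : ∀ {u} → u ∈ˢ B → u ≡ x ⊎ u ≡ y → u ≡ a ⊎ u ≡ b
  covers u∈ (inj₁ refl) = inj₁ (sym (a-is-x u∈))
  covers {u} u∈ (inj₂ refl) = case u ≟ a of λ where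
    (yes u≡a) → inj₁ u≡a
    (no u≢a)  → inj₂ (sym (b-is-y (-intro B u∈ u≢a)))

exhausts : ∀ {n} (A : VertexSet n) L → Unique L → All (_∈ˢ A) L → count A ≡ length L →
           ∀ {u} → u ∈ˢ A → u ∈ L
exhausts A L uniq L⊆A full {u} u∈A with u ∈? L
... | yes u∈L = u∈L
... | no u∉L  = case subst (0 <_) nothing-left (count-pos (A ∖ L) (∖-intro A L u∈A (¬Any⇒All¬ L u∉L))) of λ ()
  where
  nothing-left : count (A ∖ L) ≡ 0
  nothing-left = +-cancelˡ-≡ (length L) _ _
    (trans (sym (count-∖-exact A L uniq L⊆A)) (trans full (sym (+-identityʳ (length L)))))

count-all : ∀ n → count {n} (λ _ → true) ≡ n
count-all zero    = refl
count-all (suc n) = cong suc (count-all n)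

module _ {n} (G : Graph n) where

  adj-sym : ∀ {u v} → adj G u v ≡ true → adj G v u ≡ true
  adj-sym {u} {v} uv = trans (Graph.sym G v u) uv

  adj? : ∀ u v → adj G u v ≡ true ⊎ adj G u v ≡ false
  adj? u v with adj G u v
  ... | true  = inj₁ refl
  ... | false = inj₂ refl

  adj-distinct : ∀ {u v} → adj G u v ≡ true → u ≢ v
  adj-distinct {u} uv refl = case trans (sym uv) (irrefl G u) of λ ()

  non-adjacent : ∀ {u v} → ¬ (adj G u v ≡ true) → adj G u v ≡ false
  non-adjacent = ¬-not

  non-adjacent-sym : ∀ {u v} → adj G u v ≡ false → adj G v u ≡ false
  non-adjacent-sym {u} {v} u≁v = trans (Graph.sym G v u) u≁v

clash : ∀ {b} → b ≡ true → b ≡ false → ⊥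
clash refl ()

two-elements : ∀ {n} (B : VertexSet n) {a b u} → count B ≡ 2 →
               a ∈ˢ B → b ∈ˢ B → a ≢ b → u ∈ˢ B → u ≡ a ⊎ u ≡ b
two-elements B {a} {b} {u} two a∈ b∈ a≢b u∈ with u ≟ a | u ≟ b
... | yes u≡a | _       = inj₁ u≡a
... | no _    | yes u≡b = inj₂ u≡b
... | no u≢a  | no u≢b  =
  case trans (sym two) (count-∖-exact B (u ∷ a ∷ b ∷ []) distinct (u∈ ∷ a∈ ∷ b∈ ∷ [])) of λ ()
  where
  distinct : Unique (u ∷ a ∷ b ∷ [])
  distinct = (u≢a ∷ u≢b ∷ []) ∷ (a≢b ∷ []) ∷ [] ∷ []

record LowVertex {n} (G : Graph n) (A : VertexSet n) : Set where
  field
    w x y : Fin n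
    w∈A   : w ∈ˢ A
    x~y   : adj G x y ≡ true
    nbrs  : ∀ {u} → u ∈ˢ A → adj G w u ≡ true → u ≡ x ⊎ u ≡ y

low-vertex : ∀ {n} {G : Graph n} → TwoTree G → (A : VertexSet n) → ∀ {u} → u ∈ˢ A → LowVertex G A
low-vertex (base G isK3) A {w} w∈A = record
  { w = w ; x = punchIn w zero ; y = punchIn w (suc zero) ; w∈A = w∈A
  ; x~y = isK3 _ _ (λ eq → case punchIn-injective w zero (suc zero) eq of λ ())
  ; nbrs = nbrs }
  where
  nbrs : ∀ {u} → u ∈ˢ A → adj G w u ≡ true → u ≡ punchIn w zero ⊎ u ≡ punchIn w (suc zero)
  nbrs _ w~u with adj-distinct G w~u
  ... | w≢u with punchOut w≢u in eq
  ...   | zero     = inj₁ (trans (sym (punchIn-punchOut w≢u)) (cong (punchIn w) eq))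
  ...   | suc zero = inj₂ (trans (sym (punchIn-punchOut w≢u)) (cong (punchIn w) eq))
low-vertex (step G v a b deg2 v~a v~b a~b T) A {u₀} u₀∈A with A v in v∈A
... | true = record
  { w = v ; x = a ; y = b ; w∈A = v∈A ; x~y = a~b
  ; nbrs = λ _ v~u → two-elements (adj G v) deg2 v~a v~b (adj-distinct G a~b) v~u }
... | false = record
  { w = punchIn v L.w ; x = punchIn v L.x ; y = punchIn v L.y ; w∈A = L.w∈A ; x~y = L.x~y
  ; nbrs = nbrs }
  where
  -- v ∉ A, so A lives inside the 2-tree G - v
  v≢ : ∀ {u} → u ∈ˢ A → v ≢ u
  v≢ u∈A refl = case trans (sym v∈A) u∈A of λ ()
  L : LowVertex _ (A ∘ punchIn v)
  L = low-vertex T (A ∘ punchIn v) (trans (cong A (punchIn-punchOut (v≢ u₀∈A))) u₀∈A)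
  module L = LowVertex L
  nbrs : ∀ {u} → u ∈ˢ A → adj G (punchIn v L.w) u ≡ true → u ≡ punchIn v L.x ⊎ u ≡ punchIn v L.y
  nbrs {u} u∈A w~u = Sum.map lift lift
    (L.nbrs (subst (_∈ˢ A) (sym back) u∈A) (subst (λ z → adj G _ z ≡ true) (sym back) w~u))
    where
    back : punchIn v (punchOut (v≢ u∈A)) ≡ u
    back = punchIn-punchOut (v≢ u∈A)
    lift : ∀ {z} → punchOut (v≢ u∈A) ≡ z → u ≡ punchIn v z
    lift eq = trans (sym back) (cong (punchIn v) eq)

record Peel {n} (G : Graph n) (A : VertexSet n) : Set where
  field
    w a b : Fin n
    w∈A   : w ∈ˢ A
    a∈A   : a ∈ˢ A
    b∈A   : b ∈ˢ A
    w≢a   : w ≢ a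
    w≢b   : w ≢ b
    a≢b   : a ≢ b
    nbrs  : ∀ {u} → u ∈ˢ A → adj G w u ≡ true → u ≡ a ⊎ u ≡ b

module _ {n} {G : Graph n} {A : VertexSet n} (P : Peel G A) where
  open Peel P

  triple : List (Fin n)
  triple = w ∷ a ∷ b ∷ []

  count-rest : count A ≡ 3 + count (A ∖ triple)
  count-rest = count-∖-exact A triple ((w≢a ∷ w≢b ∷ []) ∷ (a≢b ∷ []) ∷ [] ∷ []) (w∈A ∷ a∈A ∷ b∈A ∷ [])

module _ {n} {G : Graph n} {A : VertexSet n} (L : LowVertex G A) where
  open LowVertex L

  no-three-nbrs : ∀ {z p q r} → w ≡ z → p ∈ˢ A → q ∈ˢ A → r ∈ˢ A →
                  adj G z p ≡ true → adj G z q ≡ true → adj G z r ≡ true → p ≢ q → p ≢ r → q ≢ r → ⊥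
  no-three-nbrs refl p∈ q∈ r∈ zp zq zr p≢q p≢r q≢r
    with nbrs p∈ zp | nbrs q∈ zq | nbrs r∈ zr
  ... | inj₁ refl | inj₁ refl | _         = p≢q refl
  ... | inj₂ refl | inj₂ refl | _         = p≢q refl
  ... | inj₁ refl | inj₂ refl | inj₁ refl = p≢r refl
  ... | inj₁ refl | inj₂ refl | inj₂ refl = q≢r refl
  ... | inj₂ refl | inj₁ refl | inj₁ refl = q≢r refl
  ... | inj₂ refl | inj₁ refl | inj₂ refl = p≢r refl

  nbrs-adjacent : ∀ {z p q} → w ≡ z → p ∈ˢ A → q ∈ˢ A →
                  adj G z p ≡ true → adj G z q ≡ true → p ≢ q → adj G p q ≡ true
  nbrs-adjacent refl p∈ q∈ zp zq p≢q with nbrs p∈ zp | nbrs q∈ zq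
  ... | inj₁ refl | inj₁ refl = ⊥-elim (p≢q refl)
  ... | inj₁ refl | inj₂ refl = x~y
  ... | inj₂ refl | inj₁ refl = adj-sym G x~y
  ... | inj₂ refl | inj₂ refl = ⊥-elim (p≢q refl)

  low⇒peel : 3 ≤ count A → Peel G A
  low⇒peel three with cover-pair (A - w) x y (shrink A w∈A three)
  ... | a , b , a∈ , b∈ , covers with -elim A a∈ | -elim (A - w) b∈
  ...   | a∈A , a≢w | b∈′ , b≢a with -elim A b∈′
  ...     | b∈A , b≢w = record
    { w = w ; a = a ; b = b ; w∈A = w∈A ; a∈A = a∈A ; b∈A = b∈A
    ; w≢a = a≢w ∘ sym ; w≢b = b≢w ∘ sym ; a≢b = b≢a ∘ sym
    ; nbrs = λ u∈A w~u → covers (-intro A u∈A (adj-distinct G w~u ∘ sym)) (nbrs u∈A w~u) }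

module TwoTreeFacts {n} {G : Graph n} (T : TwoTree G) where

  private
    _~_ : Fin n → Fin n → Set
    u ~ v = adj G u v ≡ true
    ~sym : ∀ {u v} → u ~ v → v ~ u
    ~sym = adj-sym G
    ~≢ : ∀ {u v} → u ~ v → u ≢ v
    ~≢ = adj-distinct G

  module Quadruple (u₁ u₂ u₃ u₄ : Fin n) where
    Qs : List (Fin n)
    Qs = u₁ ∷ u₂ ∷ u₃ ∷ u₄ ∷ []

    Q : VertexSet n
    Q = ⟦ Qs ⟧

    u₁∈ : u₁ ∈ˢ Q
    u₁∈ = ⟦⟧-intro Qs (here refl)
    u₂∈ : u₂ ∈ˢ Q
    u₂∈ = ⟦⟧-intro Qs (there (here refl))
    u₃∈ : u₃ ∈ˢ Q
    u₃∈ = ⟦⟧-intro Qs (there (there (here refl)))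
    u₄∈ : u₄ ∈ˢ Q
    u₄∈ = ⟦⟧-intro Qs (there (there (there (here refl))))

    L : LowVertex G Q
    L = low-vertex T Q {u₁} u₁∈

    low : LowVertex.w L ∈ Qs
    low = ⟦⟧-elim Qs (LowVertex.w∈A L)

  -- 2-trees contain no K4: the low vertex among the four would have three
  -- neighbours among them.
  K4-free : ∀ {a b c d} → a ~ b → a ~ c → a ~ d → b ~ c → b ~ d → c ~ d → ⊥
  K4-free {a} {b} {c} {d} ab ac ad bc bd cd = by-position low
    where
    open Quadruple a b c d
    by-position : LowVertex.w L ∈ Qs → ⊥
    by-position (here w≡a) =
      no-three-nbrs L w≡a u₂∈ u₃∈ u₄∈ ab ac ad (~≢ bc) (~≢ bd) (~≢ cd)
    by-position (there (here w≡b)) =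
      no-three-nbrs L w≡b u₁∈ u₃∈ u₄∈ (~sym ab) bc bd (~≢ ac) (~≢ ad) (~≢ cd)
    by-position (there (there (here w≡c))) =
      no-three-nbrs L w≡c u₁∈ u₂∈ u₄∈ (~sym ac) (~sym bc) cd (~≢ ab) (~≢ ad) (~≢ bd)
    by-position (there (there (there (here w≡d)))) =
      no-three-nbrs L w≡d u₁∈ u₂∈ u₃∈ (~sym ad) (~sym bd) (~sym cd) (~≢ ab) (~≢ ac) (~≢ bc)

  -- A 4-cycle u₁u₂u₃u₄ without the diagonal u₁u₃ has the diagonal u₂u₄: the
  -- low vertex among the four has its two cycle neighbours adjacent.
  chord : ∀ {u₁ u₂ u₃ u₄} → u₁ ~ u₂ → u₂ ~ u₃ → u₃ ~ u₄ → u₄ ~ u₁ →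
          u₁ ≢ u₃ → u₂ ≢ u₄ → adj G u₁ u₃ ≡ false → u₂ ~ u₄
  chord {u₁} {u₂} {u₃} {u₄} e₁₂ e₂₃ e₃₄ e₄₁ u₁≢u₃ u₂≢u₄ u₁≁u₃ = by-position low
    where
    open Quadruple u₁ u₂ u₃ u₄
    by-position : LowVertex.w L ∈ Qs → u₂ ~ u₄
    by-position (here w≡u₁) =
      nbrs-adjacent L w≡u₁ u₂∈ u₄∈ e₁₂ (~sym e₄₁) u₂≢u₄
    by-position (there (here w≡u₂)) =
      ⊥-elim (clash (nbrs-adjacent L w≡u₂ u₁∈ u₃∈ (~sym e₁₂) e₂₃ u₁≢u₃) u₁≁u₃)
    by-position (there (there (here w≡u₃))) =
      nbrs-adjacent L w≡u₃ u₂∈ u₄∈ (~sym e₂₃) e₃₄ u₂≢u₄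
    by-position (there (there (there (here w≡u₄)))) =
      ⊥-elim (clash (nbrs-adjacent L w≡u₄ u₁∈ u₃∈ e₄₁ (~sym e₃₄) u₁≢u₃) u₁≁u₃)

  -- Two non-adjacent common neighbours z₁, z₂ of an edge ab have no third
  -- common neighbour e besides a and b: e would be adjacent to a and b by
  -- chord, and {a, b, e, z₁} would be a K4.
  book-lemma : ∀ {a b z₁ z₂ e} → a ~ b → z₁ ≢ z₂ → adj G z₁ z₂ ≡ false →
               z₁ ~ a → z₁ ~ b → z₂ ~ a → z₂ ~ b → e ~ z₁ → e ~ z₂ → e ≢ a → e ≢ b → ⊥
  book-lemma {a} {b} {z₁} {z₂} {e} ab z₁≢z₂ z₁≁z₂ z₁a z₁b z₂a z₂b ez₁ ez₂ e≢a e≢b =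
    K4-free ab (~sym ea) (~sym z₁a) (~sym eb) (~sym z₁b) ez₁
    where
    ea : e ~ a
    ea = chord (~sym ez₁) ez₂ z₂a (~sym z₁a) z₁≢z₂ e≢a z₁≁z₂
    eb : e ~ b
    eb = chord (~sym ez₁) ez₂ z₂b (~sym z₁b) z₁≢z₂ e≢b z₁≁z₂

  peel : (A : VertexSet n) → 3 ≤ count A → Peel G A
  peel A three with member A (≤-trans (s≤s z≤n) three)
  ... | u , u∈A = low⇒peel (low-vertex T A u∈A) three

shape : (N m₁ m₂ a b : ℕ) → Bool
shape N m₁ m₂ a b with a <ᵇ N | b <ᵇ N
... | true  | true  = not (a ≡ᵇ b) ∧ not (((a ≡ᵇ m₁) ∧ (b ≡ᵇ m₂)) ∨ ((b ≡ᵇ m₁) ∧ (a ≡ᵇ m₂)))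
... | true  | false = a <ᵇ 2 * (b ∸ N) + 2
... | false | true  = b <ᵇ 2 * (a ∸ N) + 2
... | false | false = false

adjGt-shape : ∀ t u v → adjGt t u v ≡ shape (2 * t + 2) (2 * t ∸ 1) (2 * t + 1) (toℕ u) (toℕ v)
adjGt-shape t u v with toℕ u <ᵇ 2 * t + 2 | toℕ v <ᵇ 2 * t + 2
... | true  | true  = refl
... | true  | false = refl
... | false | true  = refl
... | false | false = refl

double-suc : ∀ t → 2 * suc t ≡ 2 + 2 * t
double-suc = solve-∀

-- For t = k + 1 ≥ 1 the parameters of G(3t+5) are those of G(3t+2)
-- raised by two (this needs t ≥ 1 because of the truncated 2t ∸ 1).
adjGt-suc : ∀ k u v → adjGt (suc (suc k)) u v ≡
            shape (2 + (2 * suc k + 2)) (2 + (2 * suc k ∸ 1)) (2 + (2 * suc k + 1)) (toℕ u) (toℕ v)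
adjGt-suc k u v = begin
  adjGt (suc (suc k)) u v
    ≡⟨ adjGt-shape (suc (suc k)) u v ⟩
  shape (2 * suc (suc k) + 2) (2 * suc (suc k) ∸ 1) (2 * suc (suc k) + 1) (toℕ u) (toℕ v)
    ≡⟨ cong (λ d → shape (d + 2) (d ∸ 1) (d + 1) (toℕ u) (toℕ v)) (double-suc (suc k)) ⟩
  shape (2 + (2 * suc k + 2)) (suc (2 * suc k)) (2 + (2 * suc k + 1)) (toℕ u) (toℕ v)
    ≡⟨ cong (λ d → shape (2 + (2 * suc k + 2)) (suc d) (2 + (2 * suc k + 1)) (toℕ u) (toℕ v)) (double-suc k) ⟩
  shape (2 + (2 * suc k + 2)) (3 + 2 * k) (2 + (2 * suc k + 1)) (toℕ u) (toℕ v)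
    ≡⟨ cong (λ d → shape (2 + (2 * suc k + 2)) (2 + (d ∸ 1)) (2 + (2 * suc k + 1)) (toℕ u) (toℕ v)) (sym (double-suc k)) ⟩
  shape (2 + (2 * suc k + 2)) (2 + (2 * suc k ∸ 1)) (2 + (2 * suc k + 1)) (toℕ u) (toℕ v) ∎
  where open ≡-Reasoning

<ᵇ-true⇒< : ∀ {a N} → (a <ᵇ N) ≡ true → a < N
<ᵇ-true⇒< {zero}  {suc N} _ = s≤s z≤n
<ᵇ-true⇒< {suc a} {suc N} h = s≤s (<ᵇ-true⇒< {a} {N} h)

<ᵇ-false⇒≥ : ∀ {a N} → (a <ᵇ N) ≡ false → N ≤ a
<ᵇ-false⇒≥ {a}     {zero}  _ = z≤n
<ᵇ-false⇒≥ {suc a} {suc N} h = s≤s (<ᵇ-false⇒≥ {a} {N} h)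

≥⇒<ᵇ-false : ∀ {a N} → N ≤ a → (a <ᵇ N) ≡ false
≥⇒<ᵇ-false z≤n = refl
≥⇒<ᵇ-false (s≤s N≤a) = ≥⇒<ᵇ-false N≤a

-- The shift sends the indices of G(3t+2) (with N = 2t+2) to those of
-- G(3t+5), skipping v₁ = 0, v₂ = 1 and x₁ = N + 2.
shift : ℕ → ℕ → ℕ
shift N a = if a <ᵇ N then 2 + a else 3 + a

<ᵇ-false-suc : ∀ {a N} → (a <ᵇ N) ≡ false → (suc a <ᵇ N) ≡ false
<ᵇ-false-suc {a} {N} h = ≥⇒<ᵇ-false (m≤n⇒m≤1+n (<ᵇ-false⇒≥ {a} {N} h))

offset-suc : ∀ {a N} → (a <ᵇ N) ≡ false → 2 * (suc a ∸ N) + 2 ≡ 2 + (2 * (a ∸ N) + 2)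
offset-suc {a} {N} h = begin
  2 * (suc a ∸ N) + 2   ≡⟨ cong (λ k → 2 * k + 2) (+-∸-assoc 1 (<ᵇ-false⇒≥ {a} {N} h)) ⟩
  2 * suc (a ∸ N) + 2   ≡⟨ cong (_+ 2) (double-suc (a ∸ N)) ⟩
  2 + (2 * (a ∸ N) + 2) ∎
  where open ≡-Reasoning

module _ (N m₁ m₂ a b : ℕ) where
  shape-vv : (a <ᵇ N) ≡ true → (b <ᵇ N) ≡ true →
             shape N m₁ m₂ a b ≡ (not (a ≡ᵇ b) ∧ not (((a ≡ᵇ m₁) ∧ (b ≡ᵇ m₂)) ∨ ((b ≡ᵇ m₁) ∧ (a ≡ᵇ m₂))))
  shape-vv ea eb rewrite ea | eb = refl

  shape-vx : (a <ᵇ N) ≡ true → (b <ᵇ N) ≡ false → shape N m₁ m₂ a b ≡ (a <ᵇ 2 * (b ∸ N) + 2)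
  shape-vx ea eb rewrite ea | eb = refl

  shape-xv : (a <ᵇ N) ≡ false → (b <ᵇ N) ≡ true → shape N m₁ m₂ a b ≡ (b <ᵇ 2 * (a ∸ N) + 2)
  shape-xv ea eb rewrite ea | eb = refl

  shape-xx : (a <ᵇ N) ≡ false → (b <ᵇ N) ≡ false → shape N m₁ m₂ a b ≡ false
  shape-xx ea eb rewrite ea | eb = refl

-- The shift is an isomorphism onto its image.
-- By the four cases: indices below N move up by two, the others by three,
-- so that x ∸ N grows by one for every x above the vᵢ.
shape-shift : ∀ N m₁ m₂ a b → shape (2 + N) (2 + m₁) (2 + m₂) (shift N a) (shift N b) ≡ shape N m₁ m₂ a b
shape-shift N m₁ m₂ a b with a <ᵇ N in ea | b <ᵇ N in eb
... | true  | true  = shape-vv (2 + N) (2 + m₁) (2 + m₂) (2 + a) (2 + b) ea eb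
... | true  | false = trans (shape-vx (2 + N) (2 + m₁) (2 + m₂) (2 + a) (3 + b) ea (<ᵇ-false-suc {b} {N} eb))
                            (cong (2 + a <ᵇ_) (offset-suc {b} {N} eb))
... | false | true  = trans (shape-xv (2 + N) (2 + m₁) (2 + m₂) (3 + a) (2 + b) (<ᵇ-false-suc {a} {N} ea) eb)
                            (cong (2 + b <ᵇ_) (offset-suc {a} {N} ea))
... | false | false = shape-xx (2 + N) (2 + m₁) (2 + m₂) (3 + a) (3 + b) (<ᵇ-false-suc {a} {N} ea) (<ᵇ-false-suc {b} {N} eb)

0<ᵇ+2 : ∀ k → (0 <ᵇ k + 2) ≡ true
0<ᵇ+2 zero    = refl
0<ᵇ+2 (suc k) = refl

1<ᵇ+2 : ∀ k → (1 <ᵇ k + 2) ≡ true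
1<ᵇ+2 zero    = refl
1<ᵇ+2 (suc k) = 0<ᵇ+2 k

shape-v₁ : ∀ N m₁ m₂ j → j ≢ 0 → shape (2 + N) (2 + m₁) (2 + m₂) 0 j ≡ true
shape-v₁ N m₁ m₂ zero    j≢0 = ⊥-elim (j≢0 refl)
shape-v₁ N m₁ m₂ (suc j) _ with suc j <ᵇ 2 + N
... | true  = cong not (∧-zeroʳ (suc j ≡ᵇ 2 + m₁))
... | false = 0<ᵇ+2 (2 * (suc j ∸ (2 + N)))

shape-v₂ : ∀ N m₁ m₂ j → j ≢ 1 → shape (2 + N) (2 + m₁) (2 + m₂) 1 j ≡ true
shape-v₂ N m₁ m₂ zero          _   = refl
shape-v₂ N m₁ m₂ (suc zero)    j≢1 = ⊥-elim (j≢1 refl)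
shape-v₂ N m₁ m₂ (suc (suc j)) _ with suc (suc j) <ᵇ 2 + N
... | true  = cong not (∧-zeroʳ (suc (suc j) ≡ᵇ 2 + m₁))
... | false = 1<ᵇ+2 (2 * (suc (suc j) ∸ (2 + N)))

shift-≤ : ∀ N a → shift N a ≤ 3 + a
shift-≤ N a with a <ᵇ N
... | true  = n≤1+n (2 + a)
... | false = ≤-refl

shift-≥2 : ∀ N a → 2 ≤ shift N a
shift-≥2 N a with a <ᵇ N
... | true  = s≤s (s≤s z≤n)
... | false = s≤s (s≤s z≤n)

shift-injective : ∀ N a b → shift N a ≡ shift N b → a ≡ b
shift-injective N a b eq with a <ᵇ N in ea | b <ᵇ N in eb
... | true  | true  = suc-injective (suc-injective eq)
... | false | false = suc-injective (suc-injective (suc-injective eq))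
... | true  | false with suc-injective (suc-injective eq)
...   | refl = ⊥-elim (≤⇒≯ (<ᵇ-false⇒≥ {b} {N} eb) (≤-trans (n≤1+n _) (<ᵇ-true⇒< {a} {N} ea)))
shift-injective N a b eq | false | true with suc-injective (suc-injective eq)
...   | refl = ⊥-elim (≤⇒≯ (<ᵇ-false⇒≥ {a} {N} ea) (≤-trans (n≤1+n _) (<ᵇ-true⇒< {b} {N} eb)))

shift-≢x₁ : ∀ N a → shift N a ≢ 2 + N
shift-≢x₁ N a eq with a <ᵇ N in ea
... | true  = <-irrefl (suc-injective (suc-injective eq)) (<ᵇ-true⇒< {a} {N} ea)
... | false = ≤⇒≯ (<ᵇ-false⇒≥ {a} {N} ea) (≤-reflexive (suc-injective (suc-injective eq)))

size-suc : ∀ t → 3 * suc t + 2 ≡ 3 + (3 * t + 2)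
size-suc = solve-∀

vertex-count-≤ : ∀ t → 2 * t + 2 ≤ 3 * t + 2
vertex-count-≤ t = +-monoˡ-≤ 2 (+-monoʳ-≤ t (m≤n+m (t + 0) t))

module Growth (k : ℕ) where

  t N : ℕ
  t = suc k
  N = 2 * t + 2

  private
    below : ∀ {m} → m < 3 + (3 * t + 2) → m < 3 * suc t + 2
    below {m} m< = subst (m <_) (sym (size-suc t)) m<

    shift-below : ∀ (i : Fin (3 * t + 2)) → shift N (toℕ i) < 3 * suc t + 2
    shift-below i = below (≤-trans (s≤s (shift-≤ N (toℕ i))) (+-monoʳ-≤ 3 (toℕ<n i)))

    v₁< : 0 < 3 * suc t + 2
    v₁< = below (s≤s z≤n)
    v₂< : 1 < 3 * suc t + 2
    v₂< = below (s≤s (s≤s z≤n))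
    x₁< : 2 + N < 3 * suc t + 2
    x₁< = below (s≤s (s≤s (s≤s (vertex-count-≤ t))))

  v₁ v₂ x₁ : Fin (3 * suc t + 2)
  v₁ = fromℕ< v₁<
  v₂ = fromℕ< v₂<
  x₁ = fromℕ< x₁<

  shiftᶠ : Fin (3 * t + 2) → Fin (3 * suc t + 2)
  shiftᶠ i = fromℕ< (shift-below i)

  toℕ-shiftᶠ : ∀ i → toℕ (shiftᶠ i) ≡ shift N (toℕ i)
  toℕ-shiftᶠ i = toℕ-fromℕ< (shift-below i)

  toℕ-v₁ : toℕ v₁ ≡ 0
  toℕ-v₁ = toℕ-fromℕ< v₁<

  toℕ-v₂ : toℕ v₂ ≡ 1
  toℕ-v₂ = toℕ-fromℕ< v₂<

  toℕ-x₁ : toℕ x₁ ≡ 2 + N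
  toℕ-x₁ = toℕ-fromℕ< x₁<

  private
    m₁′ m₂′ : ℕ
    m₁′ = 2 + (2 * t ∸ 1)
    m₂′ = 2 + (2 * t + 1)

    distinct-by-toℕ : ∀ {m} {i j : Fin m} → toℕ i ≢ toℕ j → i ≢ j
    distinct-by-toℕ ne eq = ne (cong toℕ eq)

  v₁≢v₂ : v₁ ≢ v₂
  v₁≢v₂ = distinct-by-toℕ λ eq → case trans (sym toℕ-v₁) (trans eq toℕ-v₂) of λ ()

  v₁≢x₁ : v₁ ≢ x₁
  v₁≢x₁ = distinct-by-toℕ λ eq → case trans (sym toℕ-v₁) (trans eq toℕ-x₁) of λ ()

  v₂≢x₁ : v₂ ≢ x₁
  v₂≢x₁ = distinct-by-toℕ λ eq → case trans (sym toℕ-v₂) (trans eq toℕ-x₁) of λ ()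

  shiftᶠ≢v₁ : ∀ i → shiftᶠ i ≢ v₁
  shiftᶠ≢v₁ i = distinct-by-toℕ λ eq →
    case ≤-trans (shift-≥2 N (toℕ i)) (≤-reflexive (trans (sym (toℕ-shiftᶠ i)) (trans eq toℕ-v₁))) of λ ()

  shiftᶠ≢v₂ : ∀ i → shiftᶠ i ≢ v₂
  shiftᶠ≢v₂ i = distinct-by-toℕ λ eq →
    case ≤-trans (shift-≥2 N (toℕ i)) (≤-reflexive (trans (sym (toℕ-shiftᶠ i)) (trans eq toℕ-v₂))) of λ { (s≤s ()) }

  shiftᶠ≢x₁ : ∀ i → shiftᶠ i ≢ x₁
  shiftᶠ≢x₁ i = distinct-by-toℕ λ eq →
    shift-≢x₁ N (toℕ i) (trans (sym (toℕ-shiftᶠ i)) (trans eq toℕ-x₁))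

  shiftᶠ-injective : ∀ {i j} → shiftᶠ i ≡ shiftᶠ j → i ≡ j
  shiftᶠ-injective {i} {j} eq =
    toℕ-injective (shift-injective N _ _ (trans (sym (toℕ-shiftᶠ i)) (trans (cong toℕ eq) (toℕ-shiftᶠ j))))

  shiftᶠ-adj : ∀ i j → adjGt (suc t) (shiftᶠ i) (shiftᶠ j) ≡ adjGt t i j
  shiftᶠ-adj i j = begin
    adjGt (suc t) (shiftᶠ i) (shiftᶠ j)
      ≡⟨ adjGt-suc k (shiftᶠ i) (shiftᶠ j) ⟩
    shape (2 + N) m₁′ m₂′ (toℕ (shiftᶠ i)) (toℕ (shiftᶠ j))
      ≡⟨ cong₂ (shape (2 + N) m₁′ m₂′) (toℕ-shiftᶠ i) (toℕ-shiftᶠ j) ⟩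
    shape (2 + N) m₁′ m₂′ (shift N (toℕ i)) (shift N (toℕ j))
      ≡⟨ shape-shift N (2 * t ∸ 1) (2 * t + 1) (toℕ i) (toℕ j) ⟩
    shape N (2 * t ∸ 1) (2 * t + 1) (toℕ i) (toℕ j)
      ≡⟨ sym (adjGt-shape t i j) ⟩
    adjGt t i j ∎
    where open ≡-Reasoning

  v₁-universal : ∀ j → j ≢ v₁ → adjGt (suc t) v₁ j ≡ true
  v₁-universal j j≢v₁ = trans (adjGt-suc k v₁ j)
    (subst (λ z → shape (2 + N) m₁′ m₂′ z (toℕ j) ≡ true) (sym toℕ-v₁)
      (shape-v₁ N (2 * t ∸ 1) (2 * t + 1) (toℕ j) (λ eq → j≢v₁ (toℕ-injective (trans eq (sym toℕ-v₁))))))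

  v₂-universal : ∀ j → j ≢ v₂ → adjGt (suc t) v₂ j ≡ true
  v₂-universal j j≢v₂ = trans (adjGt-suc k v₂ j)
    (subst (λ z → shape (2 + N) m₁′ m₂′ z (toℕ j) ≡ true) (sym toℕ-v₂)
      (shape-v₂ N (2 * t ∸ 1) (2 * t + 1) (toℕ j) (λ eq → j≢v₂ (toℕ-injective (trans eq (sym toℕ-v₂))))))

record Embedding {n m} (G : Graph n) (A : VertexSet n) (H : Graph m) : Set where
  field
    map       : Fin n → Fin m
    injective : ∀ {u v} → u ∈ˢ A → v ∈ˢ A → map u ≡ map v → u ≡ v
    preserves : ∀ {u v} → u ∈ˢ A → v ∈ˢ A → adj G u v ≡ true → adj H (map u) (map v) ≡ true

-- Let (w, a, b) be a peelable triple of A and t ≥ 1.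
-- An embedding of A ∖ {w, a, b} into G(3t+2) extends to an embedding of A
-- into G(3t+5): send a, b to the universal vertices v₁, v₂, send w to x₁
-- (whose neighbours are v₁ and v₂), and shift everything else.
module Extend {n} {G : Graph n} {A : VertexSet n} (k : ℕ) (P : Peel G A)
              (E : Embedding G (A ∖ triple P) (Gt (suc k))) where
  open Peel P
  open Growth k
  module E = Embedding E

  data Role (u : Fin n) : Set where
    is-a  : u ≡ a → Role u
    is-b  : u ≡ b → Role u
    is-w  : u ≡ w → Role u
    other : All (u ≢_) (triple P) → Role u

  role : ∀ u → Role u
  role u with u ≟ a | u ≟ b | u ≟ w
  ... | yes u≡a | _       | _       = is-a u≡a
  ... | no _    | yes u≡b | _       = is-b u≡b
  ... | no _    | no _    | yes u≡w = is-w u≡w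
  ... | no u≢a  | no u≢b  | no u≢w  = other (u≢w ∷ u≢a ∷ u≢b ∷ [])

  in-rest : ∀ {u} → u ∈ˢ A → All (u ≢_) (triple P) → u ∈ˢ (A ∖ triple P)
  in-rest = ∖-intro A (triple P)

  place : ∀ {u} → Role u → Fin (3 * suc t + 2)
  place (is-a _)      = v₁
  place (is-b _)      = v₂
  place (is-w _)      = x₁
  place {u} (other _) = shiftᶠ (E.map u)

  place-injective : ∀ {u v} → u ∈ˢ A → v ∈ˢ A → (ru : Role u) (rv : Role v) → place ru ≡ place rv → u ≡ v
  place-injective _ _ (is-a refl) (is-a refl) _  = refl
  place-injective _ _ (is-b refl) (is-b refl) _  = refl
  place-injective _ _ (is-w refl) (is-w refl) _  = refl
  place-injective _ _ (is-a _)  (is-b _)  eq = ⊥-elim (v₁≢v₂ eq)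
  place-injective _ _ (is-a _)  (is-w _)  eq = ⊥-elim (v₁≢x₁ eq)
  place-injective _ _ (is-b _)  (is-a _)  eq = ⊥-elim (v₁≢v₂ (sym eq))
  place-injective _ _ (is-b _)  (is-w _)  eq = ⊥-elim (v₂≢x₁ eq)
  place-injective _ _ (is-w _)  (is-a _)  eq = ⊥-elim (v₁≢x₁ (sym eq))
  place-injective _ _ (is-w _)  (is-b _)  eq = ⊥-elim (v₂≢x₁ (sym eq))
  place-injective _ _ (other _) (is-a _)  eq = ⊥-elim (shiftᶠ≢v₁ _ eq)
  place-injective _ _ (other _) (is-b _)  eq = ⊥-elim (shiftᶠ≢v₂ _ eq)
  place-injective _ _ (other _) (is-w _)  eq = ⊥-elim (shiftᶠ≢x₁ _ eq)
  place-injective _ _ (is-a _)  (other _) eq = ⊥-elim (shiftᶠ≢v₁ _ (sym eq))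
  place-injective _ _ (is-b _)  (other _) eq = ⊥-elim (shiftᶠ≢v₂ _ (sym eq))
  place-injective _ _ (is-w _)  (other _) eq = ⊥-elim (shiftᶠ≢x₁ _ (sym eq))
  place-injective u∈ v∈ (other u∉) (other v∉) eq =
    E.injective (in-rest u∈ u∉) (in-rest v∈ v∉) (shiftᶠ-injective eq)

  not-a-or-b : ∀ {u} → All (u ≢_) (triple P) → u ≡ a ⊎ u ≡ b → ⊥
  not-a-or-b (_ ∷ u≢a ∷ _ ∷ []) (inj₁ u≡a) = u≢a u≡a
  not-a-or-b (_ ∷ _ ∷ u≢b ∷ []) (inj₂ u≡b) = u≢b u≡b

  -- Edges are preserved: v₁ and v₂ see every other vertex, the neighbours
  -- of w in A are a and b, and among the other vertices the shift is an
  -- isomorphism.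
  place-adj : ∀ {u v} → u ∈ˢ A → v ∈ˢ A → adj G u v ≡ true → (ru : Role u) (rv : Role v) →
              adjGt (suc t) (place ru) (place rv) ≡ true
  place-adj u∈ v∈ uv (is-a e) rv =
    v₁-universal (place rv) λ eq → adj-distinct G uv (place-injective u∈ v∈ (is-a e) rv (sym eq))
  place-adj u∈ v∈ uv (is-b e) rv =
    v₂-universal (place rv) λ eq → adj-distinct G uv (place-injective u∈ v∈ (is-b e) rv (sym eq))
  place-adj u∈ v∈ uv ru (is-a e) = adj-sym (Gt (suc t)) {v₁} {place ru}
    (v₁-universal (place ru) λ eq → adj-distinct G uv (place-injective u∈ v∈ ru (is-a e) eq))
  place-adj u∈ v∈ uv ru (is-b e) = adj-sym (Gt (suc t)) {v₂} {place ru}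
    (v₂-universal (place ru) λ eq → adj-distinct G uv (place-injective u∈ v∈ ru (is-b e) eq))
  place-adj u∈ v∈ uv (is-w refl) (is-w refl) = ⊥-elim (adj-distinct G uv refl)
  place-adj u∈ v∈ uv (is-w refl) (other v∉) = ⊥-elim (not-a-or-b v∉ (nbrs v∈ uv))
  place-adj u∈ v∈ uv (other u∉) (is-w refl) = ⊥-elim (not-a-or-b u∉ (nbrs u∈ (adj-sym G uv)))
  place-adj {u} {v} u∈ v∈ uv (other u∉) (other v∉) =
    trans (shiftᶠ-adj (E.map u) (E.map v)) (E.preserves (in-rest u∈ u∉) (in-rest v∈ v∉) uv)

  extended : Embedding G A (Gt (suc t))
  extended = record
    { map       = λ u → place (role u)
    ; injective = λ u∈ v∈ → place-injective u∈ v∈ (role _) (role _)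
    ; preserves = λ u∈ v∈ uv → place-adj u∈ v∈ uv (role _) (role _)
    }

pattern v₁ = zero
pattern v₂ = suc zero
pattern v₃ = suc (suc zero)
pattern v₄ = suc (suc (suc zero))
pattern v₅ = suc (suc (suc (suc zero)))
pattern v₆ = suc (suc (suc (suc (suc zero))))
pattern x₁ = suc (suc (suc (suc (suc (suc zero)))))
pattern x₂ = suc (suc (suc (suc (suc (suc (suc zero))))))

-- The eight non-edges of G(8): x₁ sees only v₁, v₂; x₂ misses v₅, v₆;
-- and the edge v₄v₆ is removed.
non-edges₈ : List (Fin 8 × Fin 8)
non-edges₈ = (x₁ , v₃) ∷ (x₁ , v₄) ∷ (x₁ , v₅) ∷ (x₁ , v₆) ∷ (x₁ , x₂) ∷ (x₂ , v₅) ∷ (x₂ , v₆) ∷ (v₄ , v₆) ∷ []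

-- Every pair of vertices of G(8) is an edge, a loop, or a listed non-edge
-- (checked by evaluation over all 64 pairs; kept abstract, as only the
-- statement is used).
abstract
  G₈-pairs : ∀ i j → adjGt 2 i j ≡ true ⊎ i ≡ j ⊎ (i , j) ∈ non-edges₈ ⊎ (j , i) ∈ non-edges₈
  G₈-pairs = toWitness {a? = all? λ i → all? λ j →
    (adjGt 2 i j Bool.≟ true) ⊎-dec (i ≟ j) ⊎-dec listed (i , j) ⊎-dec listed (j , i)} _
    where
    listed : ∀ e → Dec (e ∈ non-edges₈)
    listed e = Any.any? (≡-dec _≟_ _≟_ e) non-edges₈

module _ {n} {G : Graph n} where

  Fits : (Fin 8 → Fin n) → Set
  Fits r = All (λ e → adj G (r (proj₁ e)) (r (proj₂ e)) ≡ false) non-edges₈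

  fits-adj : ∀ {r} → Fits r → ∀ i j → adj G (r i) (r j) ≡ true → adjGt 2 i j ≡ true
  fits-adj fits i j rirj with G₈-pairs i j
  ... | inj₁ edge                 = edge
  ... | inj₂ (inj₁ refl)          = ⊥-elim (adj-distinct G rirj refl)
  ... | inj₂ (inj₂ (inj₁ ij∈))    = ⊥-elim (clash rirj (All.lookup fits ij∈))
  ... | inj₂ (inj₂ (inj₂ ji∈))    = ⊥-elim (clash (adj-sym G rirj) (All.lookup fits ji∈))

  fitting-embedding : ∀ {U : VertexSet n} (r : Fin 8 → Fin n) → (∀ {u} → u ∈ˢ U → ∃ λ i → r i ≡ u) →
                      Fits r → Embedding G U (Gt 2)
  fitting-embedding {U} r covers fits = record
    { map = position
    ; injective = λ u∈ v∈ eq → trans (sym (position-spec u∈)) (trans (cong r eq) (position-spec v∈))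
    ; preserves = λ {u} {v} u∈ v∈ uv → fits-adj fits (position u) (position v)
        (subst₂ (λ u′ v′ → adj G u′ v′ ≡ true) (sym (position-spec u∈)) (sym (position-spec v∈)) uv)
    }
    where
    position : Fin n → Fin 8
    position u with any? (λ i → r i ≟ u)
    ... | yes (i , _) = i
    ... | no _        = zero
    position-spec : ∀ {u} → u ∈ˢ U → r (position u) ≡ u
    position-spec {u} u∈ with any? (λ i → r i ≟ u)
    ... | yes (i , ri≡u) = ri≡u
    ... | no none        = ⊥-elim (none (covers u∈))

-- An arrangement lists, for v₁ … v₆, x₁, x₂, the label of the vertex put
-- there; it has to use every label.
Onto : Vec (Fin 8) 8 → Set
Onto σ = ∀ k → ∃ λ i → Vec.lookup σ i ≡ k

onto? : ∀ σ → Dec (Onto σ)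
onto? σ = all? λ k → any? λ i → Vec.lookup σ i ≟ k

-- Eight vertices exhausting U, with the non-adjacencies forced by two
-- successive peelings (y; c, d) and (s; a, b): y sees none of s, a, b, p, q
-- and s sees neither p nor q.
record Configuration {n} (G : Graph n) (U : VertexSet n) : Set where
  field
    y c d s a b p q : Fin n
    exhaustive : ∀ {u} → u ∈ˢ U → u ∈ (q ∷ p ∷ s ∷ a ∷ b ∷ y ∷ c ∷ d ∷ [])
    y≁s : adj G y s ≡ false
    y≁a : adj G y a ≡ false
    y≁b : adj G y b ≡ false
    y≁p : adj G y p ≡ false
    y≁q : adj G y q ≡ false
    s≁p : adj G s p ≡ false
    s≁q : adj G s q ≡ false
    a≢b : a ≢ b
    p≢s : p ≢ s
    q≢s : q ≢ s
    q≢p : q ≢ p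
    a≢c : a ≢ c
    a≢d : a ≢ d
    b≢c : b ≢ c
    b≢d : b ≢ d

-- Every 8-element vertex set U of a 2-tree has a configuration: peel a
-- triple (y; c, d) off U, then a triple (s; a, b) off the remaining five
-- vertices, and let p, q be the last two.
configuration : ∀ {n} {G : Graph n} → TwoTree G → (U : VertexSet n) → count U ≡ 8 → Configuration G U
configuration {n} {G} T U eight = record
  { y = P₁.w ; c = P₁.a ; d = P₁.b ; s = P₂.w ; a = P₂.a ; b = P₂.b ; p = p ; q = q
  ; exhaustive = exhausts U members members-unique members-in-U eight
  ; y≁s = y≁ P₂.w∈A ; y≁a = y≁ P₂.a∈A ; y≁b = y≁ P₂.b∈A ; y≁p = y≁ p∈ ; y≁q = y≁ q∈
  ; s≁p = s≁ p∈ p≢a p≢b ; s≁q = s≁ q∈ q≢a q≢b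
  ; a≢b = P₂.a≢b ; p≢s = p≢s ; q≢s = q≢s ; q≢p = q≢p
  ; a≢c = not-c (not-ycd P₂.a∈A) ; a≢d = not-d (not-ycd P₂.a∈A)
  ; b≢c = not-c (not-ycd P₂.b∈A) ; b≢d = not-d (not-ycd P₂.b∈A)
  }
  where
  open TwoTreeFacts T
  P₁ : Peel G U
  P₁ = peel U (subst (3 ≤_) (sym eight) (s≤s (s≤s (s≤s z≤n))))
  module P₁ = Peel P₁

  first : List (Fin n)
  first = triple P₁

  U₁ : VertexSet n
  U₁ = U ∖ first

  five : count U₁ ≡ 5
  five = +-cancelˡ-≡ 3 _ _ (trans (sym (count-rest P₁)) eight)

  in-U : ∀ {u} → u ∈ˢ U₁ → u ∈ˢ U
  in-U = proj₁ ∘ ∖-elim U first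

  not-ycd : ∀ {u} → u ∈ˢ U₁ → All (u ≢_) first
  not-ycd = proj₂ ∘ ∖-elim U first

  not-c : ∀ {u} → All (u ≢_) first → u ≢ P₁.a
  not-c (_ ∷ u≢c ∷ _) = u≢c

  not-d : ∀ {u} → All (u ≢_) first → u ≢ P₁.b
  not-d (_ ∷ _ ∷ u≢d ∷ _) = u≢d

  P₂ : Peel G U₁
  P₂ = peel U₁ (subst (3 ≤_) (sym five) (s≤s (s≤s (s≤s z≤n))))
  module P₂ = Peel P₂

  p-choice : ∃ λ u → u ∈ˢ U₁ × All (u ≢_) (P₂.w ∷ P₂.a ∷ P₂.b ∷ [])
  p-choice = pick U₁ _ (subst (3 <_) (sym five) (s≤s (s≤s (s≤s (s≤s z≤n)))))
  p : Fin n
  p = proj₁ p-choice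
  p∈ : p ∈ˢ U₁
  p∈ = proj₁ (proj₂ p-choice)
  p∉ : All (p ≢_) (P₂.w ∷ P₂.a ∷ P₂.b ∷ [])
  p∉ = proj₂ (proj₂ p-choice)

  q-choice : ∃ λ u → u ∈ˢ U₁ × All (u ≢_) (p ∷ P₂.w ∷ P₂.a ∷ P₂.b ∷ [])
  q-choice = pick U₁ _ (subst (4 <_) (sym five) (s≤s (s≤s (s≤s (s≤s (s≤s z≤n))))))
  q : Fin n
  q = proj₁ q-choice
  q∈ : q ∈ˢ U₁
  q∈ = proj₁ (proj₂ q-choice)
  q∉ : All (q ≢_) (p ∷ P₂.w ∷ P₂.a ∷ P₂.b ∷ [])
  q∉ = proj₂ (proj₂ q-choice)

  p≢s : p ≢ P₂.w
  p≢s = All.head p∉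
  p≢a : p ≢ P₂.a
  p≢a = All.head (All.tail p∉)
  p≢b : p ≢ P₂.b
  p≢b = All.head (All.tail (All.tail p∉))
  q≢p : q ≢ p
  q≢p = All.head q∉
  q≢s : q ≢ P₂.w
  q≢s = All.head (All.tail q∉)
  q≢a : q ≢ P₂.a
  q≢a = All.head (All.tail (All.tail q∉))
  q≢b : q ≢ P₂.b
  q≢b = All.head (All.tail (All.tail (All.tail q∉)))

  members : List (Fin n)
  members = q ∷ p ∷ P₂.w ∷ P₂.a ∷ P₂.b ∷ P₁.w ∷ P₁.a ∷ P₁.b ∷ []

  members-unique : Unique members
  members-unique =
      ++⁺ q∉ (not-ycd q∈)
    ∷ ++⁺ p∉ (not-ycd p∈)
    ∷ ++⁺ (P₂.w≢a ∷ P₂.w≢b ∷ []) (not-ycd P₂.w∈A)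
    ∷ ++⁺ (P₂.a≢b ∷ []) (not-ycd P₂.a∈A)
    ∷ not-ycd P₂.b∈A
    ∷ (P₁.w≢a ∷ P₁.w≢b ∷ [])
    ∷ (P₁.a≢b ∷ [])
    ∷ []
    ∷ []

  members-in-U : All (_∈ˢ U) members
  members-in-U = in-U q∈ ∷ in-U p∈ ∷ in-U P₂.w∈A ∷ in-U P₂.a∈A ∷ in-U P₂.b∈A ∷ P₁.w∈A ∷ P₁.a∈A ∷ P₁.b∈A ∷ []

  y≁ : ∀ {u} → u ∈ˢ U₁ → adj G P₁.w u ≡ false
  y≁ u∈ = non-adjacent G λ yu → [ not-c (not-ycd u∈) , not-d (not-ycd u∈) ]′ (P₁.nbrs (in-U u∈) yu)

  s≁ : ∀ {u} → u ∈ˢ U₁ → u ≢ P₂.a → u ≢ P₂.b → adj G P₂.w u ≡ false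
  s≁ u∈ u≢a u≢b = non-adjacent G λ su → [ u≢a , u≢b ]′ (P₂.nbrs u∈ su)

module Placement {n} {G : Graph n} (T : TwoTree G) {U : VertexSet n} (K : Configuration G U) where
  open TwoTreeFacts T
  open Configuration K

  vertex : Fin 8 → Fin n
  vertex = lookup (q ∷ p ∷ s ∷ a ∷ b ∷ y ∷ c ∷ d ∷ [])

  Q P S A B Y C D : Fin 8
  Q = # 0
  P = # 1
  S = # 2
  A = # 3
  B = # 4
  Y = # 5
  C = # 6
  D = # 7

  arranged-covers : ∀ σ → Onto σ → ∀ {u} → u ∈ˢ U → ∃ λ i → vertex (Vec.lookup σ i) ≡ u
  arranged-covers σ onto u∈ with exhaustive u∈
  ... | u∈L with onto (index u∈L)
  ...   | i , σi≡k = i , trans (cong vertex σi≡k) (sym (lookup-index u∈L))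

  arrange : (σ : Vec (Fin 8) 8) → {True (onto? σ)} → Fits {G = G} (vertex ∘ Vec.lookup σ) → Embedding G U (Gt 2)
  arrange σ {onto} = fitting-embedding (vertex ∘ Vec.lookup σ) (arranged-covers σ (toWitness {a? = onto? σ} onto))

  private
    _~_ _≁_ : Fin n → Fin n → Set
    u ~ v = adj G u v ≡ true
    u ≁ v = adj G u v ≡ false

    ≁-sym : ∀ {u v} → u ≁ v → v ≁ u
    ≁-sym = non-adjacent-sym G

  -- The book case: s, p, q are pairwise non-adjacent common neighbours
  -- ("pages") of the edge ab ("spine").
  module Book (ab : a ~ b) (sa : s ~ a) (sb : s ~ b) (pa : p ~ a) (pb : p ~ b)
              (qa : q ~ a) (qb : q ~ b) (p≁q : p ≁ q) where

    Page : Fin n → Set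
    Page z = z ~ a × z ~ b

    shared : ∀ {z₁ z₂ e} → Page z₁ → Page z₂ → z₁ ≢ z₂ → z₁ ≁ z₂ → e ~ z₁ → e ~ z₂ → e ≢ a → e ≢ b → ⊥
    shared (z₁a , z₁b) (z₂a , z₂b) z₁≢z₂ z₁≁z₂ = book-lemma ab z₁≢z₂ z₁≁z₂ z₁a z₁b z₂a z₂b

    Touches : Fin n → Set
    Touches z = z ~ c ⊎ z ~ d

    touches? : ∀ z → Touches z ⊎ (z ≁ c × z ≁ d)
    touches? z with adj? G z c | adj? G z d
    ... | inj₁ zc | _       = inj₁ (inj₁ zc)
    ... | inj₂ _  | inj₁ zd = inj₁ (inj₂ zd)
    ... | inj₂ zc | inj₂ zd = inj₂ (zc , zd)

    c≢a : c ≢ a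
    c≢a = a≢c ∘ sym
    c≢b : c ≢ b
    c≢b = b≢c ∘ sym
    d≢a : d ≢ a
    d≢a = a≢d ∘ sym
    d≢b : d ≢ b
    d≢b = b≢d ∘ sym

    -- By pigeonhole two of the three pages would share c or d.
    not-all-touch : Touches s → Touches p → Touches q → ⊥
    not-all-touch (inj₁ sc) (inj₁ pc) _ = shared (sa , sb) (pa , pb) (p≢s ∘ sym) s≁p (adj-sym G sc) (adj-sym G pc) c≢a c≢b
    not-all-touch (inj₂ sd) (inj₂ pd) _ = shared (sa , sb) (pa , pb) (p≢s ∘ sym) s≁p (adj-sym G sd) (adj-sym G pd) d≢a d≢b
    not-all-touch (inj₁ sc) (inj₂ pd) (inj₁ qc) = shared (sa , sb) (qa , qb) (q≢s ∘ sym) s≁q (adj-sym G sc) (adj-sym G qc) c≢a c≢b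
    not-all-touch (inj₁ sc) (inj₂ pd) (inj₂ qd) = shared (pa , pb) (qa , qb) (q≢p ∘ sym) p≁q (adj-sym G pd) (adj-sym G qd) d≢a d≢b
    not-all-touch (inj₂ sd) (inj₁ pc) (inj₁ qc) = shared (pa , pb) (qa , qb) (q≢p ∘ sym) p≁q (adj-sym G pc) (adj-sym G qc) c≢a c≢b
    not-all-touch (inj₂ sd) (inj₁ pc) (inj₂ qd) = shared (sa , sb) (qa , qb) (q≢s ∘ sym) s≁q (adj-sym G sd) (adj-sym G qd) d≢a d≢b

    -- A page z missing c and d goes to x₁ and y to x₂; of the two other pages
    -- z₁, z₂ one misses d, and goes to v₆ opposite d at v₄.
    free-page : ∀ Z Z₁ Z₂ →
      {True (onto? (A ∷ B ∷ C ∷ D ∷ Z₁ ∷ Z₂ ∷ Z ∷ Y ∷ []))} →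
      {True (onto? (A ∷ B ∷ C ∷ D ∷ Z₂ ∷ Z₁ ∷ Z ∷ Y ∷ []))} →
      Page (vertex Z₁) → Page (vertex Z₂) → vertex Z₁ ≢ vertex Z₂ → vertex Z₁ ≁ vertex Z₂ →
      vertex Z ≁ c → vertex Z ≁ d → vertex Z ≁ vertex Z₁ → vertex Z ≁ vertex Z₂ → vertex Z ≁ y →
      y ≁ vertex Z₁ → y ≁ vertex Z₂ → Embedding G U (Gt 2)
    free-page Z Z₁ Z₂ {o₁} {o₂} page₁ page₂ z₁≢z₂ z₁≁z₂ zc zd zz₁ zz₂ zy yz₁ yz₂
      with adj G d (vertex Z₂) in dz₂ | adj G d (vertex Z₁) in dz₁
    ... | false | _     = arrange (A ∷ B ∷ C ∷ D ∷ Z₁ ∷ Z₂ ∷ Z ∷ Y ∷ []) {o₁} (zc ∷ zd ∷ zz₁ ∷ zz₂ ∷ zy ∷ yz₁ ∷ yz₂ ∷ dz₂ ∷ [])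
    ... | true  | false = arrange (A ∷ B ∷ C ∷ D ∷ Z₂ ∷ Z₁ ∷ Z ∷ Y ∷ []) {o₂} (zc ∷ zd ∷ zz₂ ∷ zz₁ ∷ zy ∷ yz₂ ∷ yz₁ ∷ dz₁ ∷ [])
    ... | true  | true  = ⊥-elim (shared page₁ page₂ z₁≢z₂ z₁≁z₂ dz₁ dz₂ d≢a d≢b)

    book : Embedding G U (Gt 2)
    book with touches? s | touches? p | touches? q
    ... | inj₂ (sc , sd) | _ | _ =
      free-page S P Q (pa , pb) (qa , qb) (q≢p ∘ sym) p≁q sc sd s≁p s≁q (≁-sym y≁s) y≁p y≁q
    ... | inj₁ _ | inj₂ (pc , pd) | _ =
      free-page P S Q (sa , sb) (qa , qb) (q≢s ∘ sym) s≁q pc pd (≁-sym s≁p) p≁q (≁-sym y≁p) y≁s y≁q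
    ... | inj₁ _ | inj₁ _ | inj₂ (qc , qd) =
      free-page Q S P (sa , sb) (pa , pb) (p≢s ∘ sym) s≁p qc qd (≁-sym s≁q) (≁-sym p≁q) (≁-sym y≁q) y≁s y≁p
    ... | inj₁ ts | inj₁ tp | inj₁ tq = ⊥-elim (not-all-touch ts tp tq)

  -- When a, b, p, q span a K₂,₂: if s misses b (or a), put s at x₂ with b
  -- (or a) at v₅; v₄v₆ becomes pq, or ab when p ~ q (no K4 in a 2-tree).
  -- Otherwise s, p, q are pages of a book with spine ab.
  module Bipartite (bq : b ~ q) (bp : b ~ p) (aq : a ~ q) (ap : a ~ p) where

    a≁b : p ~ q → a ≁ b
    a≁b pq = non-adjacent G λ ab → K4-free ab ap aq bp bq pq

    -- otherwise the 4-cycle a p b s would have the chord ps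
    spine : s ~ a → s ~ b → a ~ b
    spine sa sb with adj? G a b
    ... | inj₁ ab  = ab
    ... | inj₂ a≁b = ⊥-elim (clash (chord ap (adj-sym G bp) (adj-sym G sb) sa a≢b p≢s a≁b) (≁-sym s≁p))

    embedding : Embedding G U (Gt 2)
    embedding with adj? G s b | adj? G s a | adj? G p q
    ... | inj₂ s≁b | _ | inj₂ p≁q =
      arrange (C ∷ D ∷ A ∷ P ∷ B ∷ Q ∷ Y ∷ S ∷ []) (y≁a ∷ y≁p ∷ y≁b ∷ y≁q ∷ y≁s ∷ s≁b ∷ s≁q ∷ p≁q ∷ [])
    ... | inj₂ s≁b | _ | inj₁ pq =
      arrange (C ∷ D ∷ P ∷ A ∷ Q ∷ B ∷ Y ∷ S ∷ []) (y≁p ∷ y≁a ∷ y≁q ∷ y≁b ∷ y≁s ∷ s≁q ∷ s≁b ∷ a≁b pq ∷ [])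
    ... | inj₁ _ | inj₂ s≁a | inj₂ p≁q =
      arrange (C ∷ D ∷ B ∷ P ∷ A ∷ Q ∷ Y ∷ S ∷ []) (y≁b ∷ y≁p ∷ y≁a ∷ y≁q ∷ y≁s ∷ s≁a ∷ s≁q ∷ p≁q ∷ [])
    ... | inj₁ _ | inj₂ s≁a | inj₁ pq =
      arrange (C ∷ D ∷ P ∷ B ∷ Q ∷ A ∷ Y ∷ S ∷ []) (y≁p ∷ y≁b ∷ y≁q ∷ y≁a ∷ y≁s ∷ s≁q ∷ s≁a ∷ ≁-sym (a≁b pq) ∷ [])
    ... | inj₁ sb | inj₁ sa | _ =
      Book.book (spine sa sb) sa sb (adj-sym G ap) (adj-sym G bp) (adj-sym G aq) (adj-sym G bq)
                (non-adjacent G (K4-free (spine sa sb) ap aq bp bq))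

  -- The eight vertices fit G(8): if some pair in {a, b} × {p, q} is missing,
  -- it becomes v₄v₆ with y at x₁ and s at x₂.
  embedding : Embedding G U (Gt 2)
  embedding with adj? G b q | adj? G b p | adj? G a q | adj? G a p
  ... | inj₂ b≁q | _ | _ | _ =
    arrange (C ∷ D ∷ A ∷ B ∷ P ∷ Q ∷ Y ∷ S ∷ []) (y≁a ∷ y≁b ∷ y≁p ∷ y≁q ∷ y≁s ∷ s≁p ∷ s≁q ∷ b≁q ∷ [])
  ... | inj₁ _ | inj₂ b≁p | _ | _ =
    arrange (C ∷ D ∷ A ∷ B ∷ Q ∷ P ∷ Y ∷ S ∷ []) (y≁a ∷ y≁b ∷ y≁q ∷ y≁p ∷ y≁s ∷ s≁q ∷ s≁p ∷ b≁p ∷ [])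
  ... | inj₁ _ | inj₁ _ | inj₂ a≁q | _ =
    arrange (C ∷ D ∷ B ∷ A ∷ P ∷ Q ∷ Y ∷ S ∷ []) (y≁b ∷ y≁a ∷ y≁p ∷ y≁q ∷ y≁s ∷ s≁p ∷ s≁q ∷ a≁q ∷ [])
  ... | inj₁ _ | inj₁ _ | inj₁ _ | inj₂ a≁p =
    arrange (C ∷ D ∷ B ∷ A ∷ Q ∷ P ∷ Y ∷ S ∷ []) (y≁b ∷ y≁a ∷ y≁q ∷ y≁p ∷ y≁s ∷ s≁q ∷ s≁p ∷ a≁p ∷ [])
  ... | inj₁ bq | inj₁ bp | inj₁ aq | inj₁ ap = Bipartite.embedding bq bp aq ap

embed : ∀ {n} {G : Graph n} → TwoTree G → ∀ t → 2 ≤ t →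
        (U : VertexSet n) → count U ≡ 3 * t + 2 → Embedding G U (Gt t)
embed T zero () U size
embed T (suc zero) (s≤s ()) U size
embed T (suc (suc zero)) _ U size = Placement.embedding T (configuration T U size)
embed {G = G} T (suc (suc (suc k))) _ U size =
  Extend.extended (suc k) P (embed T (suc (suc k)) (s≤s (s≤s z≤n)) (U ∖ triple P) rest-size)
  where
  size′ : count U ≡ 3 + (3 * suc (suc k) + 2)
  size′ = trans size (size-suc (suc (suc k)))
  P : Peel G U
  P = TwoTreeFacts.peel T U (subst (3 ≤_) (sym size′) (s≤s (s≤s (s≤s z≤n))))
  rest-size : count (U ∖ triple P) ≡ 3 * suc (suc k) + 2
  rest-size = +-cancelˡ-≡ 3 _ _ (trans (sym (count-rest P)) size′)

lemma4p3p2 : (t : ℕ) → 2 ≤ t → (G : Graph (3 * t + 2)) → TwoTree G → Subgraph G (Gt t)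
lemma4p3p2 t 2≤t G T =
  map , injective refl refl , λ _ _ → preserves refl refl
  where open Embedding (embed T t 2≤t (λ _ → true) (count-all (3 * t + 2)))
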